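{- For any positive integers $m,n$ such that $\frac{4}{5}\le \frac{m}{n}<1$, there is a finite connected graph $G$ with $\mu(G)=m$ and $\nu(G)=n$.
   Context: All graphs are finite, simple, undirected and loopless. For a graph $G$, $\nu(G)$ is the maximum size of a matching in $G$. $\lambda(G)=\max\{|H|+|H'| : H,H' \text{ are disjoint matchings in } G\}$, $\Lambda(G)$ is the set of ordered pairs $(H,H')$ of disjoint matchings of $G$ with $|H|+|H'|=\lambda(G)$, and $\mu(G)=\max\{|H| : \text{there is } H' \text{ with } (H,H')\in\Lambda(G)\}$. -}

module Defs where

open import Data.Nat using (ℕ; _+_; _≤_)
open import Data.Fin using (Fin)
open import Data.Bool using (Bool; true; false)
open import Data.List using (List; []; _∷_; length; concatMap)
open import Data.List.Relation.Unary.Unique.Propositional using (Unique)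
open import Data.List.Membership.Propositional using (_∈_)
open import Data.List.Relation.Unary.All using (All)
open import Data.Product using (_×_; _,_; Σ; ∃; ∃-syntax)
open import Data.Sum using (_⊎_)
open import Relation.Binary.PropositionalEquality using (_≡_)
open import Relation.Nullary using (¬_)

record Graph : Set where
  field
    order : ℕ
    adj   : Fin order → Fin order → Bool
    sym   : ∀ u v → adj u v ≡ adj v u
    irrefl : ∀ v → adj v v ≡ false
open Graph public

Edge : (G : Graph) → Set
Edge G = Fin (order G) × Fin (order G)

data Walk (G : Graph) : Fin (order G) → Fin (order G) → Set where
  here : ∀ {u} → Walk G u u
  step : ∀ {u w v} → adj G u w ≡ true → Walk G w v → Walk G u v

Connected : Graph → Set
Connected G = ∀ u v → Walk G u v

endpoints : ∀ {G : Graph} → List (Edge G) → List (Fin (order G))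
endpoints = concatMap (λ { (a , b) → a ∷ b ∷ [] })

IsMatching : (G : Graph) → List (Edge G) → Set
IsMatching G M = All (λ { (a , b) → adj G a b ≡ true }) M × Unique (endpoints {G} M)

SameEdge : ∀ {G : Graph} → Edge G → Edge G → Set
SameEdge (a , b) (c , d) = (a ≡ c × b ≡ d) ⊎ (a ≡ d × b ≡ c)

Disjoint : ∀ {G : Graph} → List (Edge G) → List (Edge G) → Set
Disjoint {G} H H' = ∀ e e' → e ∈ H → e' ∈ H' → ¬ SameEdge {G} e e'

DisjointPair : (G : Graph) → List (Edge G) → List (Edge G) → Set
DisjointPair G H H' = IsMatching G H × IsMatching G H' × Disjoint {G} H H'

NuIs : Graph → ℕ → Set
NuIs G n = (∃[ M ] (IsMatching G M × length M ≡ n))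
         × (∀ M → IsMatching G M → length M ≤ n)

LambdaIs : Graph → ℕ → Set
LambdaIs G l = (∃[ H ] ∃[ H' ] (DisjointPair G H H' × length H + length H' ≡ l))
             × (∀ H H' → DisjointPair G H H' → length H + length H' ≤ l)

InΛ : (G : Graph) → ℕ → List (Edge G) → List (Edge G) → Set
InΛ G l H H' = DisjointPair G H H' × length H + length H' ≡ l

MuIs : Graph → ℕ → Set
MuIs G m = Σ ℕ λ l → LambdaIs G l
         × (∃[ H ] ∃[ H' ] (InΛ G l H H' × length H ≡ m))
         × (∀ H H' → InΛ G l H H' → length H ≤ m)

module Submission where

-- Write m = 4k + e and n = 5k + e with k = n - m ≥ 1 and e ≥ 0.  The graph
-- is a tree T(k, e) with 2k centres, each carrying two legs
-- centre – knee – foot, and e further legs at a root; so it has 2k centres,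
-- 4k + e knees and 4k + e feet.  Its invariants follow by counting how
-- often matchings meet these three classes:
--   * ν(T) ≤ |V|/2 = 5k + e, attained by a perfect matching;
--   * knees are independent, so every edge meets a foot or a centre; feet
--     are leaves, so two disjoint matchings meet each foot at most once in
--     total; hence λ(T) ≤ (4k + e) + 2·2k, attained by explicit H, H';
--   * for (H, H') ∈ Λ(T), 2|H| + |H'| ≤ #knees + #feet + 2·#centres
--     = λ(T) + 4k + e, whence |H| ≤ 4k + e, with equality for that pair.

open import Defs hiding (sym)
open import Data.Bool using (Bool; true; false; T; _∨_)
open import Data.Bool.Properties using (∨-comm)
open import Data.Empty using (⊥; ⊥-elim)
open import Data.Fin using (Fin; zero; suc; _≟_)
open import Data.Fin.Properties using (+↔⊎; *↔×; 2↔Bool)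
open import Data.List using (List; []; _∷_; length; map; _++_; allFin; filterᵇ; cartesianProduct)
open import Data.List.Properties using (length-map; length-++; length-tabulate)
open import Data.List.Membership.Propositional using (_∈_)
open import Data.List.Membership.Propositional.Properties using (∈-map⁺; ∈-map⁻; ∈-allFin; ∈-filter⁻; ∈-++⁻)
open import Data.List.Relation.Binary.Subset.Propositional using (_⊆_)
open import Data.List.Relation.Unary.All as All using (All; []; _∷_)
open import Data.List.Relation.Unary.AllPairs using ([]; _∷_)
open import Data.List.Relation.Unary.Any using (here; there)
open import Data.List.Relation.Unary.Unique.Propositional using (Unique)
import Data.List.Relation.Unary.Unique.Propositional.Properties as Unique
open import Data.Maybe using (Maybe; just; nothing)
open import Data.Maybe.Properties using (just-injective)
import Data.Maybe.Properties as Maybe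
open import Data.Nat using (ℕ; suc; _+_; _*_; _∸_; _≤_; _<_; z≤n; s≤s)
open import Data.Nat.Properties
  using ( ≤-refl; +-assoc; +-suc; +-mono-≤; +-monoˡ-≤; +-monoʳ-≤; +-cancelˡ-≤; +-cancelʳ-≤; *-cancelʳ-≤
        ; m+[n∸m]≡n; module ≤-Reasoning)
open import Data.Nat.Tactic.RingSolver using (solve-∀)
open import Data.Product using (_×_; _,_; Σ; ∃-syntax; proj₁; proj₂)
open import Data.Product.Function.NonDependent.Propositional using (_×-↔_)
open import Data.Sum using (_⊎_; inj₁; inj₂)
open import Data.Sum.Function.Propositional using (_⊎-↔_)
open import Function using (_∘_)
open import Function.Bundles using (Inverse; _↔_)
open import Function.Properties.Inverse using (↔-refl; ↔-trans)
open import Relation.Binary.PropositionalEquality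
  using (_≡_; _≢_; refl; sym; trans; cong; cong₂; subst; subst₂; module ≡-Reasoning)
open import Relation.Nullary using (¬_; Dec; yes; no; does)
open import Relation.Nullary.Decidable using (T?; dec-true; dec-false; map′)

remove : ∀ {A : Set} {x : A} {ys} → x ∈ ys →
         Σ (List A) λ ys' → length ys ≡ suc (length ys') × (∀ {z} → z ∈ ys → z ≢ x → z ∈ ys')
remove {ys = y ∷ ys} (here refl) =
  ys , refl , λ { (here refl) z≢x → ⊥-elim (z≢x refl) ; (there z∈) _ → z∈ }
remove {ys = y ∷ ys} (there x∈) with remove x∈
... | ys' , len , keep =
  y ∷ ys' , cong suc len , λ { (here refl) _ → here refl ; (there z∈) z≢x → there (keep z∈ z≢x) }

pigeonhole : ∀ {A : Set} {xs ys : List A} → Unique xs → xs ⊆ ys → length xs ≤ length ys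
pigeonhole {xs = []} _ _ = z≤n
pigeonhole {xs = x ∷ xs} (x∉xs ∷ u) xs⊆ys with remove (xs⊆ys (here refl))
... | ys' , len , keep = subst (suc (length xs) ≤_) (sym len)
  (s≤s (pigeonhole u λ z∈ → keep (xs⊆ys (there z∈)) λ z≡x → All.lookup x∉xs z∈ (sym z≡x)))

module Enumeration {A : Set} {n : ℕ} (enc : Fin n ↔ A) where
  open Inverse enc

  enumerate : List A
  enumerate = map to (allFin n)

  length-enumerate : length enumerate ≡ n
  length-enumerate = trans (length-map to (allFin n)) (length-tabulate (λ i → i))

  ∈-enumerate : ∀ x → x ∈ enumerate
  ∈-enumerate x = subst (_∈ enumerate) (strictlyInverseˡ x) (∈-map⁺ to (∈-allFin (from x)))

  enumerate-unique : Unique enumerate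
  enumerate-unique = Unique.map⁺ to-injective (Unique.allFin⁺ n)
    where
    to-injective : ∀ {i j} → to i ≡ to j → i ≡ j
    to-injective {i} {j} eq = trans (sym (strictlyInverseʳ i)) (trans (cong from eq) (strictlyInverseʳ j))

module _ {G : Graph} where
  _++ʷ_ : ∀ {u v w} → Walk G u v → Walk G v w → Walk G u w
  here ++ʷ q = q
  step a p ++ʷ q = step a (p ++ʷ q)

  reverseʷ : ∀ {u v} → Walk G u v → Walk G v u
  reverseʷ here = here
  reverseʷ (step {u} {w} a p) = reverseʷ p ++ʷ step (trans (Graph.sym G w u) a) here

connected-via : ∀ {G} (r : Fin (order G)) → (∀ u → Walk G u r) → Connected G
connected-via r toR u v = toR u ++ʷ reverseʷ (toR v)

bit : Bool → ℕ
bit true = 1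
bit false = 0

module MatchingFacts (G : Graph) where
  V : Set
  V = Fin (order G)

  hits : (V → Bool) → List (Edge G) → ℕ
  hits p [] = 0
  hits p ((a , b) ∷ M) = bit (p a) + bit (p b) + hits p M

  Partition : (p q r : V → Bool) → Set
  Partition p q r = ∀ u → bit (p u) + bit (q u) + bit (r u) ≡ 1

  Independent : (V → Bool) → Set
  Independent p = ∀ u v → adj G u v ≡ true → T (p u) → T (p v) → ⊥

  Leaves : (V → Bool) → Set
  Leaves p = ∀ u w w' → T (p u) → adj G u w ≡ true → adj G u w' ≡ true → w ≡ w'

  length-endpoints : ∀ M → length (endpoints {G} M) ≡ length M * 2
  length-endpoints [] = refl
  length-endpoints (_ ∷ M) = cong (λ l → suc (suc l)) (length-endpoints M)

  met : (V → Bool) → List (Edge G) → List V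
  met p M = filterᵇ p (endpoints {G} M)

  met-unique : ∀ p {M} → IsMatching G M → Unique (met p M)
  met-unique p {M} (_ , distinct) = Unique.filter⁺ (T? ∘ p) {endpoints {G} M} distinct

  met-endpoint : ∀ p {M u} → u ∈ met p M → u ∈ endpoints {G} M × T (p u)
  met-endpoint p {M} = ∈-filter⁻ (T? ∘ p) {xs = endpoints {G} M}

  length-filterᵇ-∷ : ∀ p b (xs : List V) →
                     length (filterᵇ p (b ∷ xs)) ≡ bit (p b) + length (filterᵇ p xs)
  length-filterᵇ-∷ p b xs with p b
  ... | true  = refl
  ... | false = refl

  length-met : ∀ p M → length (met p M) ≡ hits p M
  length-met p [] = refl
  length-met p ((a , b) ∷ M) = begin
    length (filterᵇ p (a ∷ b ∷ endpoints {G} M))       ≡⟨ length-filterᵇ-∷ p a _ ⟩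
    bit (p a) + length (filterᵇ p (b ∷ endpoints {G} M)) ≡⟨ cong (bit (p a) +_) (length-filterᵇ-∷ p b _) ⟩
    bit (p a) + (bit (p b) + length (met p M))         ≡⟨ +-assoc (bit (p a)) _ _ ⟨
    bit (p a) + bit (p b) + length (met p M)           ≡⟨ cong (bit (p a) + bit (p b) +_) (length-met p M) ⟩
    hits p ((a , b) ∷ M)                               ∎
    where open ≡-Reasoning

  incident : ∀ {M v} → IsMatching G M → v ∈ endpoints {G} M →
             ∃[ w ] (adj G v w ≡ true × ((v , w) ∈ M ⊎ (w , v) ∈ M))
  incident {(a , b) ∷ M} (ab ∷ _ , _) (here refl) = b , ab , inj₁ (here refl)
  incident {(a , b) ∷ M} (ab ∷ _ , _) (there (here refl)) = a , trans (Graph.sym G b a) ab , inj₂ (here refl)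
  incident {(a , b) ∷ M} (_ ∷ edges , _ ∷ _ ∷ distinct) (there (there v∈))
    with incident (edges , distinct) v∈
  ... | w , vw , inj₁ e∈ = w , vw , inj₁ (there e∈)
  ... | w , vw , inj₂ e∈ = w , vw , inj₂ (there e∈)

  open ≤-Reasoning

  matching-size : ∀ {M} → IsMatching G M → length M * 2 ≤ order G
  matching-size {M} (_ , distinct) = begin
    length M * 2                ≡⟨ length-endpoints M ⟨
    length (endpoints {G} M)    ≤⟨ pigeonhole distinct (λ {v} _ → ∈-allFin v) ⟩
    length (allFin (order G))   ≡⟨ length-tabulate (λ i → i) ⟩
    order G                     ∎

  hits-≤ : ∀ p (S : List V) → (∀ {u} → T (p u) → u ∈ S) →
           ∀ {M} → IsMatching G M → hits p M ≤ length S
  hits-≤ p S inS {M} m = begin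
    hits p M            ≡⟨ length-met p M ⟨
    length (met p M)    ≤⟨ pigeonhole (met-unique p m) (inS ∘ proj₂ ∘ met-endpoint p {M}) ⟩
    length S            ∎

  -- Two disjoint matchings together meet a class of leaves at most once per
  -- leaf: both edges at a leaf would be its unique edge.
  hits-leaves : ∀ p (S : List V) → (∀ {u} → T (p u) → u ∈ S) → Leaves p →
                ∀ {H H'} → DisjointPair G H H' → hits p H + hits p H' ≤ length S
  hits-leaves p S inS leaf {H} {H'} (mH , mH' , disjoint) = begin
    hits p H + hits p H'                   ≡⟨ cong₂ _+_ (length-met p H) (length-met p H') ⟨
    length (met p H) + length (met p H')   ≡⟨ length-++ (met p H) ⟨
    length (met p H ++ met p H')           ≤⟨ pigeonhole (Unique.++⁺ (met-unique p mH) (met-unique p mH') separate)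
                                                         (inS ∘ class) ⟩
    length S                               ∎
    where
    class : ∀ {u} → u ∈ met p H ++ met p H' → T (p u)
    class u∈ with ∈-++⁻ (met p H) u∈
    ... | inj₁ u∈H  = proj₂ (met-endpoint p {H} u∈H)
    ... | inj₂ u∈H' = proj₂ (met-endpoint p {H'} u∈H')

    separate : ∀ {v} → ¬ (v ∈ met p H × v ∈ met p H')
    separate (v∈H , v∈H') with met-endpoint p {H} v∈H | met-endpoint p {H'} v∈H'
    ... | v∈ , pv | v∈' , _ with incident mH v∈ | incident mH' v∈'
    ... | w , vw , e | w' , vw' , e' with leaf _ w w' pv vw vw'
    ... | refl with e | e'
    ... | inj₁ e∈ | inj₁ e∈' = disjoint _ _ e∈ e∈' (inj₁ (refl , refl))
    ... | inj₁ e∈ | inj₂ e∈' = disjoint _ _ e∈ e∈' (inj₂ (refl , refl))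
    ... | inj₂ e∈ | inj₁ e∈' = disjoint _ _ e∈ e∈' (inj₂ (refl , refl))
    ... | inj₂ e∈ | inj₂ e∈' = disjoint _ _ e∈ e∈' (inj₁ (refl , refl))

  hits-partition : ∀ {p q r} → Partition p q r → ∀ M →
                   hits p M + hits q M + hits r M ≡ length M * 2
  hits-partition part [] = refl
  hits-partition {p} {q} {r} part ((a , b) ∷ M) = begin-equality
    (bit (p a) + bit (p b) + hits p M) + (bit (q a) + bit (q b) + hits q M) + (bit (r a) + bit (r b) + hits r M)
      ≡⟨ regroup (bit (p a)) (bit (p b)) (hits p M) (bit (q a)) (bit (q b)) (hits q M) (bit (r a)) (bit (r b)) (hits r M) ⟩
    (bit (p a) + bit (q a) + bit (r a)) + (bit (p b) + bit (q b) + bit (r b)) + (hits p M + hits q M + hits r M)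
      ≡⟨ cong₂ _+_ (cong₂ _+_ (part a) (part b)) (hits-partition part M) ⟩
    suc (length M) * 2 ∎
    where
    regroup : ∀ pa pb hp qa qb hq ra rb hr →
              (pa + pb + hp) + (qa + qb + hq) + (ra + rb + hr) ≡ (pa + qa + ra) + (pb + qb + rb) + (hp + hq + hr)
    regroup = solve-∀

  hits-independent : ∀ {p} → Independent p → ∀ {M} → IsMatching G M → hits p M ≤ length M
  hits-independent {p} indep {[]} _ = z≤n
  hits-independent {p} indep {(a , b) ∷ M} (ab ∷ edges , _ ∷ _ ∷ distinct) =
    +-mono-≤ at-most-one (hits-independent indep (edges , distinct))
    where
    at-most-one : bit (p a) + bit (p b) ≤ 1
    at-most-one with p a in pa | p b in pb
    ... | true  | true  = ⊥-elim (indep a b ab (subst T (sym pa) _) (subst T (sym pb) _))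
    ... | true  | false = ≤-refl
    ... | false | true  = ≤-refl
    ... | false | false = z≤n

  length-≤-hits : ∀ {p q r} → Partition p q r → Independent p →
                  ∀ {M} → IsMatching G M → length M ≤ hits q M + hits r M
  length-≤-hits {p} {q} {r} part indep {M} m = +-cancelˡ-≤ (length M) _ _ (begin
    length M + length M                  ≡⟨ double (length M) ⟩
    length M * 2                         ≡⟨ hits-partition part M ⟨
    hits p M + hits q M + hits r M       ≡⟨ +-assoc (hits p M) _ _ ⟩
    hits p M + (hits q M + hits r M)     ≤⟨ +-monoˡ-≤ _ (hits-independent indep m) ⟩
    length M + (hits q M + hits r M)     ∎)
    where
    double : ∀ l → l + l ≡ l * 2
    double = solve-∀

  labelled-matching : ∀ {L : Set} (f : L → Edge G) (label : V → Maybe (L × Bool)) →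
    (∀ ℓ → adj G (proj₁ (f ℓ)) (proj₂ (f ℓ)) ≡ true) →
    (∀ ℓ → label (proj₁ (f ℓ)) ≡ just (ℓ , false)) →
    (∀ ℓ → label (proj₂ (f ℓ)) ≡ just (ℓ , true)) →
    ∀ {xs} → Unique xs → IsMatching G (map f xs)
  labelled-matching {L} f label edge first second {xs} distinct = edges xs ,
    Unique.map⁻ (subst Unique (sym (labels xs))
      (Unique.map⁺ just-injective (Unique.cartesianProduct⁺ distinct sides)))
    where
    edges : ∀ ys → All (λ { (a , b) → adj G a b ≡ true }) (map f ys)
    edges [] = []
    edges (ℓ ∷ ys) = edge ℓ ∷ edges ys

    sides : Unique (false ∷ true ∷ [])
    sides = ((λ ()) ∷ []) ∷ [] ∷ []

    labels : ∀ ys → map label (endpoints {G} (map f ys)) ≡ map just (cartesianProduct ys (false ∷ true ∷ []))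
    labels [] = refl
    labels (ℓ ∷ ys) = cong₂ _∷_ (first ℓ) (cong₂ _∷_ (second ℓ) (labels ys))

module ParentForest {V : Set} {N : ℕ} (enc : Fin N ↔ V) (parent : V → Maybe V)
                    (no-self-parent : ∀ x → parent x ≢ just x) where
  open Inverse enc public
    using () renaming ( to to decode; from to code
                      ; strictlyInverseˡ to decode-code; strictlyInverseʳ to code-decode)

  code-injective : ∀ {x y} → code x ≡ code y → x ≡ y
  code-injective {x} {y} eq = trans (sym (decode-code x)) (trans (cong decode eq) (decode-code y))

  _≟ᵛ_ : (x y : V) → Dec (x ≡ y)
  x ≟ᵛ y = map′ code-injective (cong code) (code x ≟ code y)

  parent? : (x y : V) → Dec (parent x ≡ just y)
  parent? x y = Maybe.≡-dec _≟ᵛ_ (parent x) (just y)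

  points-to : Fin N → Fin N → Bool
  points-to u v = does (parent? (decode u) (decode v))

  forest : Graph
  forest = record
    { order  = N
    ; adj    = λ u v → points-to u v ∨ points-to v u
    ; sym    = λ u v → ∨-comm (points-to u v) (points-to v u)
    ; irrefl = λ u → cong (λ b → b ∨ b)
                          (dec-false (parent? (decode u) (decode u)) (no-self-parent (decode u)))
    }

  child-adjacent : ∀ {x y} → parent x ≡ just y → adj forest (code x) (code y) ≡ true
  child-adjacent {x} {y} xy
    rewrite dec-true (parent? (decode (code x)) (decode (code y)))
                     (subst₂ (λ a b → parent a ≡ just b) (sym (decode-code x)) (sym (decode-code y)) xy)
    = refl

  parent-adjacent : ∀ {x y} → parent x ≡ just y → adj forest (code y) (code x) ≡ true
  parent-adjacent {x} {y} xy = trans (Graph.sym forest (code y) (code x)) (child-adjacent xy)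

  adjacent-parent : ∀ {u v} → adj forest u v ≡ true →
                    parent (decode u) ≡ just (decode v) ⊎ parent (decode v) ≡ just (decode u)
  adjacent-parent {u} {v} uv with parent? (decode u) (decode v)
  ... | yes pu = inj₁ pu
  ... | no _ with parent? (decode v) (decode u)
  ...   | yes pv = inj₂ pv
  ...   | no _ = ⊥-elim (false≢true uv)
    where
    false≢true : false ≢ true
    false≢true ()

  independent : ∀ (p : V → Bool) → (∀ {x y} → parent x ≡ just y → T (p x) → T (p y) → ⊥) →
                MatchingFacts.Independent forest (p ∘ decode)
  independent p no-pair u v uv pu pv with adjacent-parent uv
  ... | inj₁ u→v = no-pair u→v pu pv
  ... | inj₂ v→u = no-pair v→u pv pu

  leaves : ∀ (p : V → Bool) → (∀ {x y} → parent x ≡ just y → T (p y) → ⊥) →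
           MatchingFacts.Leaves forest (p ∘ decode)
  leaves p childless u w w' pu uw uw' with adjacent-parent uw | adjacent-parent uw'
  ... | inj₂ w→u | _ = ⊥-elim (childless w→u pu)
  ... | _ | inj₂ w'→u = ⊥-elim (childless w'→u pu)
  ... | inj₁ u→w | inj₁ u→w' =
    trans (sym (code-decode w)) (trans (cong code (just-injective (trans (sym u→w) u→w'))) (code-decode w'))

  data _↝_ : V → V → Set where
    stay  : ∀ {x} → x ↝ x
    climb : ∀ {x y z} → parent x ≡ just y → y ↝ z → x ↝ z

  connected : ∀ r → (∀ x → x ↝ r) → Connected forest
  connected r ancestor = connected-via (code r) λ u →
    subst (λ u → Walk forest u (code r)) (code-decode u) (ascend (ancestor (decode u)))
    where
    ascend : ∀ {x z} → x ↝ z → Walk forest (code x) (code z)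
    ascend stay = here
    ascend (climb xy yz) = step (child-adjacent xy) (ascend yz)

-- The extremal tree T(k, e), k = k' + 1.  Unit i consists of two centres
-- (i , left) and (i , right) joined by an edge; each centre carries two legs
-- α and β, a leg being a path centre – knee – foot.  The centres (i , left)
-- of units i ≠ 0 hang from the root (0 , left), which also carries e extra
-- legs.
module Tree (k' e : ℕ) where
  k : ℕ
  k = suc k'

  pattern left  = false
  pattern right = true
  pattern α = false
  pattern β = true

  Centre : Set
  Centre = Fin k × Bool

  UnitLeg : Set
  UnitLeg = Centre × Bool

  Leg : Set
  Leg = UnitLeg ⊎ Fin e

  pattern unitLeg c l = inj₁ (c , l)
  pattern extraLeg t  = inj₂ t

  Vertex : Set
  Vertex = Centre ⊎ (Leg ⊎ Leg)

  pattern centre c = inj₁ c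
  pattern knee ℓ   = inj₂ (inj₁ ℓ)
  pattern foot ℓ   = inj₂ (inj₂ ℓ)

  legCount : ℕ
  legCount = k * 2 * 2 + e

  centres↔ : Fin (k * 2) ↔ Centre
  centres↔ = ↔-trans *↔× (↔-refl ×-↔ 2↔Bool)

  unitLegs↔ : Fin (k * 2 * 2) ↔ UnitLeg
  unitLegs↔ = ↔-trans *↔× (centres↔ ×-↔ 2↔Bool)

  legs↔ : Fin legCount ↔ Leg
  legs↔ = ↔-trans +↔⊎ (unitLegs↔ ⊎-↔ ↔-refl)

  vertices↔ : Fin (k * 2 + (legCount + legCount)) ↔ Vertex
  vertices↔ = ↔-trans +↔⊎ (centres↔ ⊎-↔ ↔-trans +↔⊎ (legs↔ ⊎-↔ legs↔))

  root : Centre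
  root = zero , left

  anchor : Leg → Centre
  anchor (unitLeg c _) = c
  anchor (extraLeg _)  = root

  parent : Vertex → Maybe Vertex
  parent (centre (i , right))    = just (centre (i , left))
  parent (centre (zero , left))  = nothing
  parent (centre (suc _ , left)) = just (centre root)
  parent (knee ℓ)                = just (centre (anchor ℓ))
  parent (foot ℓ)                = just (knee ℓ)

  no-self-parent : ∀ x → parent x ≢ just x
  no-self-parent (centre (zero , left)) ()
  no-self-parent (centre (suc _ , left)) ()
  no-self-parent (centre (_ , right)) ()
  no-self-parent (knee _) ()
  no-self-parent (foot _) ()

  open ParentForest vertices↔ parent no-self-parent

  G : Graph
  G = forest

  left↝root : ∀ i → centre (i , left) ↝ centre root
  left↝root zero    = stay
  left↝root (suc _) = climb refl stay

  centre↝root : ∀ c → centre c ↝ centre root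
  centre↝root (i , left)  = left↝root i
  centre↝root (i , right) = climb refl (left↝root i)

  tree-connected : Connected G
  tree-connected = connected (centre root) λ
    { (centre c) → centre↝root c
    ; (knee ℓ)   → climb refl (centre↝root (anchor ℓ))
    ; (foot ℓ)   → climb refl (climb refl (centre↝root (anchor ℓ)))
    }

  isCentre isKnee isFoot : Vertex → Bool
  isCentre (centre _) = true
  isCentre (knee _)   = false
  isCentre (foot _)   = false
  isKnee (centre _) = false
  isKnee (knee _)   = true
  isKnee (foot _)   = false
  isFoot (centre _) = false
  isFoot (knee _)   = false
  isFoot (foot _)   = true

  open MatchingFacts G
  open Enumeration using (enumerate; length-enumerate; ∈-enumerate; enumerate-unique)

  C K F : V → Bool
  C = isCentre ∘ decode
  K = isKnee ∘ decode
  F = isFoot ∘ decode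

  classes : Partition K F C
  classes u with decode u
  ... | centre _ = refl
  ... | knee _   = refl
  ... | foot _   = refl

  -- A knee's parent is a centre, so no edge joins two knees.
  knees-independent : Independent K
  knees-independent = independent isKnee no-knee-pair
    where
    no-knee-pair : ∀ {x y} → parent x ≡ just y → T (isKnee x) → T (isKnee y) → ⊥
    no-knee-pair {knee _} refl _ ()

  -- Nobody's parent is a foot, so feet are leaves.
  feet-leaves : Leaves F
  feet-leaves = leaves isFoot childless
    where
    childless : ∀ {x y} → parent x ≡ just y → T (isFoot y) → ⊥
    childless {centre (_ , right)} refl ()
    childless {centre (suc _ , left)} refl ()
    childless {knee _} refl ()
    childless {foot _} refl ()

  members : ∀ {A : Set} {n} → Fin n ↔ A → (A → Vertex) → List V
  members enc f = map (code ∘ f) (enumerate enc)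

  length-members : ∀ {A : Set} {n} (enc : Fin n ↔ A) f → length (members enc f) ≡ n
  length-members enc f = trans (length-map (code ∘ f) (enumerate enc)) (length-enumerate enc)

  ∈-members : ∀ {A : Set} {n} (enc : Fin n ↔ A) f {u} a → decode u ≡ f a → u ∈ members enc f
  ∈-members enc f {u} a eq =
    subst (_∈ members enc f) (trans (cong code (sym eq)) (code-decode u))
          (∈-map⁺ (code ∘ f) (∈-enumerate enc a))

  centre-member : ∀ {u} → T (isCentre (decode u)) → u ∈ members centres↔ centre
  centre-member {u} Cu with decode u in eq
  ... | centre c = ∈-members centres↔ centre c eq
  ... | knee _   = ⊥-elim Cu
  ... | foot _   = ⊥-elim Cu

  knee-member : ∀ {u} → T (isKnee (decode u)) → u ∈ members legs↔ knee
  knee-member {u} Ku with decode u in eq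
  ... | centre _ = ⊥-elim Ku
  ... | knee ℓ   = ∈-members legs↔ knee ℓ eq
  ... | foot _   = ⊥-elim Ku

  foot-member : ∀ {u} → T (isFoot (decode u)) → u ∈ members legs↔ foot
  foot-member {u} Fu with decode u in eq
  ... | centre _ = ⊥-elim Fu
  ... | knee _   = ⊥-elim Fu
  ... | foot ℓ   = ∈-members legs↔ foot ℓ eq

  link : Vertex × Vertex → Edge G
  link (x , y) = code x , code y

  Joined : Vertex × Vertex → Set
  Joined (x , y) = parent x ≡ just y ⊎ parent y ≡ just x

  enumerated-matching : ∀ {L : Set} {n} (enc : Fin n ↔ L) (ends : L → Vertex × Vertex)
    (label : Vertex → Maybe (L × Bool)) → (∀ ℓ → Joined (ends ℓ)) →
    (∀ ℓ → label (proj₁ (ends ℓ)) ≡ just (ℓ , false)) →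
    (∀ ℓ → label (proj₂ (ends ℓ)) ≡ just (ℓ , true)) →
    IsMatching G (map (link ∘ ends) (enumerate enc)) × length (map (link ∘ ends) (enumerate enc)) ≡ n
  enumerated-matching enc ends label joined first second =
    labelled-matching (link ∘ ends) (label ∘ decode) (adjacent ∘ joined)
      (λ ℓ → trans (cong label (decode-code _)) (first ℓ))
      (λ ℓ → trans (cong label (decode-code _)) (second ℓ))
      (enumerate-unique enc) ,
    trans (length-map (link ∘ ends) (enumerate enc)) (length-enumerate enc)
    where
    adjacent : ∀ {x y} → Joined (x , y) → adj G (code x) (code y) ≡ true
    adjacent (inj₁ xy) = child-adjacent xy
    adjacent (inj₂ yx) = parent-adjacent yx

  perfectEnds : Leg ⊎ Fin k → Vertex × Vertex
  perfectEnds (inj₁ ℓ) = knee ℓ , foot ℓ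
  perfectEnds (inj₂ i) = centre (i , left) , centre (i , right)

  perfectLabel : Vertex → Maybe ((Leg ⊎ Fin k) × Bool)
  perfectLabel (centre (i , s)) = just (inj₂ i , s)
  perfectLabel (knee ℓ)         = just (inj₁ ℓ , false)
  perfectLabel (foot ℓ)         = just (inj₁ ℓ , true)

  perfectIndex↔ : Fin (legCount + k) ↔ (Leg ⊎ Fin k)
  perfectIndex↔ = ↔-trans +↔⊎ (legs↔ ⊎-↔ ↔-refl)

  M₀ : List (Edge G)
  M₀ = map (link ∘ perfectEnds) (enumerate perfectIndex↔)

  M₀-matching : IsMatching G M₀ × length M₀ ≡ legCount + k
  M₀-matching = enumerated-matching perfectIndex↔ perfectEnds perfectLabel
    (λ { (inj₁ _) → inj₂ refl ; (inj₂ _) → inj₂ refl })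
    (λ { (inj₁ _) → refl ; (inj₂ _) → refl })
    (λ { (inj₁ _) → refl ; (inj₂ _) → refl })

  hEnds : Leg → Vertex × Vertex
  hEnds (unitLeg c α) = knee (unitLeg c α) , foot (unitLeg c α)
  hEnds (unitLeg c β) = knee (unitLeg c β) , centre c
  hEnds (extraLeg t)  = knee (extraLeg t) , foot (extraLeg t)

  hLabel : Vertex → Maybe (Leg × Bool)
  hLabel (centre c) = just (unitLeg c β , true)
  hLabel (knee ℓ)   = just (ℓ , false)
  hLabel (foot ℓ)   = just (ℓ , true)

  H : List (Edge G)
  H = map (link ∘ hEnds) (enumerate legs↔)

  H-matching : IsMatching G H × length H ≡ legCount
  H-matching = enumerated-matching legs↔ hEnds hLabel
    (λ { (unitLeg _ α) → inj₂ refl ; (unitLeg _ β) → inj₁ refl ; (extraLeg _) → inj₂ refl })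
    (λ { (unitLeg _ α) → refl ; (unitLeg _ β) → refl ; (extraLeg _) → refl })
    (λ { (unitLeg _ α) → refl ; (unitLeg _ β) → refl ; (extraLeg _) → refl })

  h'Ends : UnitLeg → Vertex × Vertex
  h'Ends (c , α) = knee (unitLeg c α) , centre c
  h'Ends (c , β) = knee (unitLeg c β) , foot (unitLeg c β)

  h'Label : Vertex → Maybe (UnitLeg × Bool)
  h'Label (centre c)           = just ((c , α) , true)
  h'Label (knee (unitLeg c l)) = just ((c , l) , false)
  h'Label (foot (unitLeg c l)) = just ((c , l) , true)
  h'Label (knee (extraLeg _))  = nothing
  h'Label (foot (extraLeg _))  = nothing

  H' : List (Edge G)
  H' = map (link ∘ h'Ends) (enumerate unitLegs↔)

  H'-matching : IsMatching G H' × length H' ≡ k * 2 * 2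
  H'-matching = enumerated-matching unitLegs↔ h'Ends h'Label
    (λ { (_ , α) → inj₁ refl ; (_ , β) → inj₂ refl })
    (λ { (_ , α) → refl ; (_ , β) → refl })
    (λ { (_ , α) → refl ; (_ , β) → refl })

  SameEnds : Vertex × Vertex → Vertex × Vertex → Set
  SameEnds (x , y) (z , w) = (x ≡ z × y ≡ w) ⊎ (x ≡ w × y ≡ z)

  decode-same : ∀ a b → SameEdge {G} (link a) (link b) → SameEnds a b
  decode-same _ _ (inj₁ (p , q)) = inj₁ (code-injective p , code-injective q)
  decode-same _ _ (inj₂ (p , q)) = inj₂ (code-injective p , code-injective q)

  -- H and H' share no edge: an edge of H' continues from the knee of a unit
  -- leg to the neighbour that H does not use.
  H-H'-disjoint : Disjoint {G} H H'
  H-H'-disjoint _ _ e∈H e'∈H' same with ∈-map⁻ (link ∘ hEnds) {xs = enumerate legs↔} e∈H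
                                          | ∈-map⁻ (link ∘ h'Ends) {xs = enumerate unitLegs↔} e'∈H'
  ... | ℓ , _ , refl | u , _ , refl = apart ℓ u (decode-same (hEnds ℓ) (h'Ends u) same)
    where
    apart : ∀ ℓ u → ¬ SameEnds (hEnds ℓ) (h'Ends u)
    apart (unitLeg _ α) (_ , α) (inj₁ (_ , ()))
    apart (unitLeg _ α) (_ , β) (inj₁ (() , _))
    apart (unitLeg _ β) (_ , α) (inj₁ (() , _))
    apart (unitLeg _ β) (_ , β) (inj₁ (_ , ()))
    apart (extraLeg _)  (_ , α) (inj₁ (() , _))
    apart (extraLeg _)  (_ , β) (inj₁ (() , _))
    apart (unitLeg _ α) (_ , α) (inj₂ (() , _))
    apart (unitLeg _ α) (_ , β) (inj₂ (() , _))
    apart (unitLeg _ β) (_ , α) (inj₂ (() , _))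
    apart (unitLeg _ β) (_ , β) (inj₂ (() , _))
    apart (extraLeg _)  (_ , α) (inj₂ (() , _))
    apart (extraLeg _)  (_ , β) (inj₂ (() , _))

  open ≤-Reasoning

  λᵀ : ℕ
  λᵀ = legCount + k * 2 * 2

  ν-bound : ∀ M → IsMatching G M → length M ≤ legCount + k
  ν-bound M m = *-cancelʳ-≤ (length M) (legCount + k) 2 (begin
    length M * 2                     ≤⟨ matching-size m ⟩
    k * 2 + (legCount + legCount)    ≡⟨ halve legCount k ⟩
    (legCount + k) * 2               ∎)
    where
    halve : ∀ l k → k * 2 + (l + l) ≡ (l + k) * 2
    halve = solve-∀

  feet-centres-bound : ∀ {H H'} → DisjointPair G H H' →
                       (hits F H + hits F H') + (hits C H + hits C H') ≤ λᵀ
  feet-centres-bound {H} {H'} pair@(mH , mH' , _) = begin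
    (hits F H + hits F H') + (hits C H + hits C H')
      ≤⟨ +-mono-≤ (hits-leaves F _ foot-member feet-leaves pair)
                  (+-mono-≤ (hits-≤ C _ centre-member mH) (hits-≤ C _ centre-member mH')) ⟩
    length (members legs↔ foot) + (length (members centres↔ centre) + length (members centres↔ centre))
      ≡⟨ cong₂ _+_ (length-members legs↔ foot)
                   (cong₂ _+_ (length-members centres↔ centre) (length-members centres↔ centre)) ⟩
    legCount + (k * 2 + k * 2)
      ≡⟨ cong (legCount +_) (twice (k * 2)) ⟩
    λᵀ ∎
    where
    twice : ∀ c → c + c ≡ c * 2
    twice = solve-∀

  edges-meet-feet-centres : ∀ {M} → IsMatching G M → length M ≤ hits F M + hits C M
  edges-meet-feet-centres = length-≤-hits classes knees-independent

  λ-bound : ∀ H H' → DisjointPair G H H' → length H + length H' ≤ λᵀ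
  λ-bound H H' pair@(mH , mH' , _) = begin
    length H + length H'
      ≤⟨ +-mono-≤ (edges-meet-feet-centres mH) (edges-meet-feet-centres mH') ⟩
    (hits F H + hits C H) + (hits F H' + hits C H')
      ≡⟨ interchange (hits F H) (hits C H) (hits F H') (hits C H') ⟩
    (hits F H + hits F H') + (hits C H + hits C H')
      ≤⟨ feet-centres-bound pair ⟩
    λᵀ ∎
    where
    interchange : ∀ a b c d → (a + b) + (c + d) ≡ (a + c) + (b + d)
    interchange = solve-∀

  -- μ(T) ≤ 4k + e: counting 2|H| + |H'| against all knees, feet and centres.
  μ-bound : ∀ H H' → InΛ G λᵀ H H' → length H ≤ legCount
  μ-bound H H' (pair@(mH , mH' , _) , total) = +-cancelʳ-≤ λᵀ (length H) legCount (begin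
    length H + λᵀ
      ≡⟨ cong (length H +_) total ⟨
    length H + (length H + length H')
      ≡⟨ double (length H) (length H') ⟩
    length H * 2 + length H'
      ≡⟨ cong (_+ length H') (hits-partition classes H) ⟨
    (hits K H + hits F H + hits C H) + length H'
      ≤⟨ +-monoʳ-≤ (hits K H + hits F H + hits C H) (edges-meet-feet-centres mH') ⟩
    (hits K H + hits F H + hits C H) + (hits F H' + hits C H')
      ≡⟨ regroup (hits K H) (hits F H) (hits C H) (hits F H') (hits C H') ⟩
    hits K H + ((hits F H + hits F H') + (hits C H + hits C H'))
      ≤⟨ +-mono-≤ (hits-≤ K _ knee-member mH) (feet-centres-bound pair) ⟩
    length (members legs↔ knee) + λᵀ
      ≡⟨ cong (_+ λᵀ) (length-members legs↔ knee) ⟩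
    legCount + λᵀ ∎)
    where
    double : ∀ a b → a + (a + b) ≡ a * 2 + b
    double = solve-∀
    regroup : ∀ a b c d f → (a + b + c) + (d + f) ≡ a + ((b + d) + (c + f))
    regroup = solve-∀

  invariants : Connected G × MuIs G legCount × NuIs G (legCount + k)
  invariants =
    tree-connected ,
    (λᵀ , ((H , H' , pair , sizes) , λ-bound) , (H , H' , (pair , sizes) , proj₂ H-matching) , μ-bound) ,
    ((M₀ , M₀-matching) , ν-bound)
    where
    pair : DisjointPair G H H'
    pair = proj₁ H-matching , proj₁ H'-matching , H-H'-disjoint

    sizes : length H + length H' ≡ λᵀ
    sizes = cong₂ _+_ (proj₂ H-matching) (proj₂ H'-matching)

-- Every pair with 4/5 ≤ m/n < 1 has the form m = 4k + e, n = 5k + e with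
-- k ≥ 1: take k = n - m and e = m - 4k.
decompose : ∀ m n → 4 * n ≤ 5 * m → m < n →
            ∃[ k' ] ∃[ e ] (suc k' * 2 * 2 + e ≡ m × suc k' * 2 * 2 + e + suc k' ≡ n)
decompose m n 4n≤5m m<n = k' , m ∸ 4k , m≡ , n≡
  where
  open ≤-Reasoning
  k' : ℕ
  k' = n ∸ suc m

  4k : ℕ
  4k = suc k' * 2 * 2

  n-split : suc m + k' ≡ n
  n-split = m+[n∸m]≡n m<n

  4k≤m : 4k ≤ m
  4k≤m = +-cancelˡ-≤ (4 * m) 4k m (begin
    4 * m + 4k         ≡⟨ four-times m k' ⟩
    4 * (suc m + k')   ≡⟨ cong (4 *_) n-split ⟩
    4 * n              ≤⟨ 4n≤5m ⟩
    5 * m              ≡⟨ five-times m ⟩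
    4 * m + m          ∎)
    where
    four-times : ∀ m k' → 4 * m + suc k' * 2 * 2 ≡ 4 * (suc m + k')
    four-times = solve-∀
    five-times : ∀ m → 5 * m ≡ 4 * m + m
    five-times = solve-∀

  m≡ : 4k + (m ∸ 4k) ≡ m
  m≡ = m+[n∸m]≡n 4k≤m

  n≡ : 4k + (m ∸ 4k) + suc k' ≡ n
  n≡ = trans (cong (_+ suc k') m≡) (trans (+-suc m k') n-split)

theorem1p1 : (m n : ℕ) → 0 < m → 0 < n → 4 * n ≤ 5 * m → m < n →
    ∃[ G ] (Connected G × MuIs G m × NuIs G n)
theorem1p1 m n _ _ 4n≤5m m<n with decompose m n 4n≤5m m<n
... | k' , e , refl , refl = Tree.G k' e , Tree.invariants k' e
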